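{- Let $\mathcal A$ be an alphabet, $M(\mathcal A)$ the free magma on $\mathcal A$ with product $\star$, and $\triangleright:M(\mathcal A)_{\mathbb Q}\otimes\mathcal A\to M(\mathcal A)_{\mathbb Q}$ a linear map, extended as described in the context to $\triangleright$ on $M(\mathcal A)_{\mathbb Q}$ and on $\mathbb Q\langle M(\mathcal A)\rangle$. Assume that $\triangleright$ descends to a map $\triangleright:\mathrm{Lie}(\mathcal A)\otimes\mathrm{Lie}(\mathcal A)\to\mathrm{Lie}(\mathcal A)$, i.e. there is a bilinear map on $\mathrm{Lie}(\mathcal A)$ with $\mathrm{Lie}(x\triangleright y)=\mathrm{Lie}(x)\triangleright\mathrm{Lie}(y)$ for all $x,y\in M(\mathcal A)_{\mathbb Q}$, and that for all $x,y,z\in M(\mathcal A)_{\mathbb Q}$ \[ \mathrm{Lie}\big((x\star y-x\cdot y+y\cdot x)\triangleright z\big)=0 . \] Then $(\mathrm{Lie}(\mathcal A),[\cdot,\cdot],\triangleright)$ is a post-Lie algebra.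
   Context: $M(\mathcal A)_{\mathbb Q}$ is the $\mathbb Q$-span of the free magma, i.e. the free non-associative non-commutative algebra on $\mathcal A$ with product $\star$. The given map $\triangleright$ is extended so that for each $t\in M(\mathcal A)_{\mathbb Q}$ the map $t\triangleright$ is a derivation of $(M(\mathcal A)_{\mathbb Q},\star)$, i.e. $t\triangleright(u\star w)=(t\triangleright u)\star w+u\star(t\triangleright w)$, bilinear in $t$. Let $\mathbb Q\langle M(\mathcal A)\rangle$ be the free associative algebra (product $\cdot$) generated by the set $M(\mathcal A)$, with coproduct $\Delta$ multiplicative and $\Delta(t)=t\otimes1+1\otimes t$ for $t\in M(\mathcal A)$ (Sweedler notation $A_{(1)}\otimes A_{(2)}$). $\triangleright$ is further extended to a linear map $\mathbb Q\langle M(\mathcal A)\rangle^{\otimes2}\to\mathbb Q\langle M(\mathcal A)\rangle$ by $A\triangleright1=(A\mid1)$ (the constant term of $A$), $1\triangleright A=A$, $(x\cdot A)\triangleright y=x\triangleright(A\triangleright y)-(x\triangleright A)\triangleright y$, $A\triangleright(B\cdot C)=(A_{(1)}\triangleright B)(A_{(2)}\triangleright C)$ for $x,y\in M(\mathcal A)_{\mathbb Q}$; this extension maps $\mathbb Q\langle M(\mathcal A)\rangle\otimes M(\mathcal A)_{\mathbb Q}$ into $M(\mathcal A)_{\mathbb Q}$. $\mathrm{Lie}:M(\mathcal A)_{\mathbb Q}\to\mathrm{Lie}(\mathcal A)$ is the surjective algebra homomorphism which is the identity on $\mathcal A$ and sends $a\star b\mapsto[a,b]$, onto the free Lie algebra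 on $\mathcal A$. A post-Lie algebra is a Lie algebra $(\mathfrak g,[\cdot,\cdot])$ with bilinear $\triangleright$ satisfying $x\triangleright[y,z]=[x\triangleright y,z]+[y,x\triangleright z]$ and $[x,y]\triangleright z=x\triangleright(y\triangleright z)-(x\triangleright y)\triangleright z-y\triangleright(x\triangleright z)+(y\triangleright x)\triangleright z$. -}

module Defs where

open import Data.Nat using (ℕ; zero; suc)
open import Data.Rational using (ℚ; 0ℚ; 1ℚ; -_) renaming (_+_ to _+ℚ_; _*_ to _*ℚ_)
open import Data.Product using (Σ; _×_; _,_)
open import Data.List using (List; []; _∷_; _++_; map; concatMap)
open import Data.Vec using (Vec; []; _∷_) renaming (_++_ to _++ᵥ_)
open import Data.List.Relation.Binary.Permutation.Propositional using (_↭_)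

data Magma (𝒜 : Set) : Set where
  leaf : 𝒜 → Magma 𝒜
  _⋆ₜ_ : Magma 𝒜 → Magma 𝒜 → Magma 𝒜

-- M(𝒜)_ℚ : formal ℚ-linear combinations of magma elements.
-- (Identified up to the vector-space relations inside _∼_ below.)

MQ : Set → Set
MQ 𝒜 = List (ℚ × Magma 𝒜)

module _ {𝒜 : Set} where

  0M : MQ 𝒜
  0M = []

  _⊕_ : MQ 𝒜 → MQ 𝒜 → MQ 𝒜
  x ⊕ y = x ++ y
  infixl 6 _⊕_ _⊖_

  _•_ : ℚ → MQ 𝒜 → MQ 𝒜
  q • x = map (λ { (r , t) → (q *ℚ r , t) }) x
  infixr 8 _•_

  _⊖_ : MQ 𝒜 → MQ 𝒜 → MQ 𝒜
  x ⊖ y = x ++ ((- 1ℚ) • y)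

  ⟦_⟧ : Magma 𝒜 → MQ 𝒜
  ⟦ t ⟧ = (1ℚ , t) ∷ []

  _⋆_ : MQ 𝒜 → MQ 𝒜 → MQ 𝒜
  x ⋆ y = concatMap (λ { (q , s) → map (λ { (r , t) → (q *ℚ r , s ⋆ₜ t) }) y }) x
  infixl 7 _⋆_

  -- Free Lie algebra Lie(𝒜) over ℚ, realised as the quotient of M(𝒜)_ℚ
  -- by the two-sided ideal generated by x⋆x and the Jacobi expressions.
  -- x ∼ y means: x and y have the same image in Lie(𝒜).  The canonical
  -- map Lie : M(𝒜)_ℚ → Lie(𝒜) is then the identity on representatives
  -- and the Lie bracket [x,y] is represented by x ⋆ y.

  infix 4 _∼_
  data _∼_ : MQ 𝒜 → MQ 𝒜 → Set where
    ∼-refl  : ∀ {x} → x ∼ x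
    ∼-sym   : ∀ {x y} → x ∼ y → y ∼ x
    ∼-trans : ∀ {x y z} → x ∼ y → y ∼ z → x ∼ z
    ∼-perm  : ∀ {x y} → x ↭ y → x ∼ y
    ∼-merge : ∀ q r t x → ((q , t) ∷ (r , t) ∷ x) ∼ ((q +ℚ r , t) ∷ x)
    ∼-zero  : ∀ t x → ((0ℚ , t) ∷ x) ∼ x
    ∼-⊕     : ∀ {x x′ y y′} → x ∼ x′ → y ∼ y′ → x ⊕ y ∼ x′ ⊕ y′
    ∼-•     : ∀ q {x y} → x ∼ y → q • x ∼ q • y
    ∼-⋆     : ∀ {x x′ y y′} → x ∼ x′ → y ∼ y′ → x ⋆ y ∼ x′ ⋆ y′
    ∼-alt   : ∀ x → x ⋆ x ∼ 0M
    ∼-jacobi : ∀ x y z → x ⋆ (y ⋆ z) ⊕ y ⋆ (z ⋆ x) ⊕ z ⋆ (x ⋆ y) ∼ 0M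

  -- Extension of ▷ : M(𝒜)_ℚ ⊗ 𝒜 → M(𝒜)_ℚ (given by its values on basis
  -- elements, f t a = t ▷ a) to M(𝒜)_ℚ ⊗ M(𝒜)_ℚ, with t ▷ a derivation of ⋆.

  module Extension (f : Magma 𝒜 → 𝒜 → MQ 𝒜) where

    ▷ₜ : Magma 𝒜 → Magma 𝒜 → MQ 𝒜
    ▷ₜ t (leaf a) = f t a
    ▷ₜ t (u ⋆ₜ w) = (▷ₜ t u) ⋆ ⟦ w ⟧ ⊕ ⟦ u ⟧ ⋆ (▷ₜ t w)

    _▷_ : MQ 𝒜 → MQ 𝒜 → MQ 𝒜
    x ▷ y = concatMap (λ { (q , s) → concatMap (λ { (r , t) → (q *ℚ r) • ▷ₜ s t }) y }) x
    infixr 9 _▷_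

    -- ℚ⟨M(𝒜)⟩ : free associative algebra on the set M(𝒜); a basis word
    -- is a vector of magma elements of some length n (n = 0 is the unit 1).

    Word : Set
    Word = Σ ℕ (Vec (Magma 𝒜))

    QA : Set
    QA = List (ℚ × Word)

    ι : MQ 𝒜 → QA
    ι x = map (λ { (q , t) → (q , (1 , t ∷ [])) }) x

    _⊕A_ : QA → QA → QA
    A ⊕A B = A ++ B
    infixl 6 _⊕A_ _⊖A_

    _⊖A_ : QA → QA → QA
    A ⊖A B = A ++ map (λ { (q , w) → (- 1ℚ *ℚ q , w) }) B

    _·_ : QA → QA → QA
    A · B = concatMap (λ { (q , (m , v)) →
              map (λ { (r , (n , w)) → (q *ℚ r , (m Data.Nat.+ n , v ++ᵥ w)) }) B }) A
    infixl 7 _·_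

    -- t ▷ (word), t ∈ M(𝒜): since Δ t = t ⊗ 1 + 1 ⊗ t, the rule
    -- A ▷ (B·C) = (A₍₁₎ ▷ B)(A₍₂₎ ▷ C) makes t ▷ a derivation on words
    -- (with t ▷ 1 = (t ∣ 1) = 0 and 1 ▷ C = C).
    ▷word : Magma 𝒜 → ∀ {n} → Vec (Magma 𝒜) n → List (ℚ × Vec (Magma 𝒜) n)
    ▷word t [] = []
    ▷word t (u ∷ B) =
      map (λ { (q , s) → (q , s ∷ B) }) (▷ₜ t u) ++
      map (λ { (q , C) → (q , u ∷ C) }) (▷word t B)

    -- word ▷ element of M(𝒜)_ℚ, via 1 ▷ y = y and
    -- (x · A) ▷ y = x ▷ (A ▷ y) − (x ▷ A) ▷ y
    ▷W : (n : ℕ) → Vec (Magma 𝒜) n → MQ 𝒜 → MQ 𝒜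
    ▷W zero [] y = y
    ▷W (suc n) (x ∷ A) y =
      ⟦ x ⟧ ▷ ▷W n A y ⊖ concatMap (λ { (q , B) → q • ▷W n B y }) (▷word x A)

    _▷A_ : QA → MQ 𝒜 → MQ 𝒜
    A ▷A y = concatMap (λ { (q , (n , w)) → q • ▷W n w y }) A
    infixr 9 _▷A_

record IsBilinearOnLie {𝒜 : Set} (_◁_ : MQ 𝒜 → MQ 𝒜 → MQ 𝒜) : Set where
  field
    resp   : ∀ {x x′ y y′} → x ∼ x′ → y ∼ y′ → x ◁ y ∼ x′ ◁ y′
    addˡ   : ∀ x x′ y → (x ⊕ x′) ◁ y ∼ x ◁ y ⊕ x′ ◁ y
    addʳ   : ∀ x y y′ → x ◁ (y ⊕ y′) ∼ x ◁ y ⊕ x ◁ y′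
    scalˡ  : ∀ q x y → (q • x) ◁ y ∼ q • (x ◁ y)
    scalʳ  : ∀ q x y → x ◁ (q • y) ∼ q • (x ◁ y)

-- (Lie(𝒜), [·,·], ◁) is a post-Lie algebra; the bracket [x,y] is x ⋆ y.
-- (Lie(𝒜) is a Lie algebra by construction, and ◁ is assumed bilinear.)
record IsPostLieOnLie {𝒜 : Set} (_◁_ : MQ 𝒜 → MQ 𝒜 → MQ 𝒜) : Set where
  field
    derivation : ∀ x y z → x ◁ (y ⋆ z) ∼ (x ◁ y) ⋆ z ⊕ y ⋆ (x ◁ z)
    bracket-act : ∀ x y z →
      (x ⋆ y) ◁ z ∼ x ◁ (y ◁ z) ⊖ (x ◁ y) ◁ z ⊖ y ◁ (x ◁ z) ⊕ (y ◁ x) ◁ z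

-- Both axioms are checked on representatives in M(𝒜)_ℚ and then transported along
-- x ▷ y ∼ x ◁ y.  By bilinearity the derivation rule for ▷ reduces to basis elements,
-- where it is the defining recursion of ▷ₜ; on representatives it even holds up to a
-- permutation of terms.  For the second axiom, the rule (x · A) ▷ y = x ▷ (A ▷ y) − (x ▷ A) ▷ y
-- on words of length two gives (ι x · ι y) ▷A z = a(x, y, z) with the associator
-- a(x, y, z) = x ▷ (y ▷ z) − (x ▷ y) ▷ z, so the hypothesis says precisely that
-- (x ⋆ y) ▷ z = a(x, y, z) − a(y, x, z), which is the post-Lie identity for [x, y] ▷ z.

module Submission where

open import Defs
open import Data.Product using (_×_; _,_)
open import Data.Rational using (ℚ; 0ℚ; 1ℚ; -_) renaming (_+_ to _+ℚ_; _*_ to _*ℚ_)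
open import Data.Rational.Properties using (*-assoc; *-comm; *-identityʳ)
open import Data.Rational.Solver using (module +-*-Solver)
open import Data.List using (List; []; _∷_; _++_; map; concatMap)
open import Data.List.Properties using (++-assoc; ++-identityʳ; map-++; concatMap-++)
open import Data.List.Relation.Binary.Permutation.Propositional
  using (_↭_; ↭-sym; ↭-reflexive; module PermutationReasoning)
open import Data.List.Relation.Binary.Permutation.Propositional.Properties
  using (++⁺ˡ; ++⁺; ++-comm; shift; shifts)
open import Data.Vec using () renaming (_∷_ to _∷ᵥ_; [] to []ᵥ)
open import Relation.Binary.PropositionalEquality
  using (_≡_; refl; sym; trans; cong; cong₂; module ≡-Reasoning)
open import Relation.Binary.Bundles using (Setoid)
import Relation.Binary.Reasoning.Setoid as SetoidReasoning

open +-*-Solver using (solve; _:=_; _:+_; _:*_; con)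

++-interchange : {A : Set} (a b c d : List A) → (a ++ b) ++ (c ++ d) ↭ (a ++ c) ++ (b ++ d)
++-interchange a b c d = begin
  (a ++ b) ++ (c ++ d)  ≡⟨ ++-assoc a b (c ++ d) ⟩
  a ++ (b ++ (c ++ d))  ↭⟨ ++⁺ˡ a (shifts b c) ⟩
  a ++ (c ++ (b ++ d))  ≡⟨ ++-assoc a c (b ++ d) ⟨
  (a ++ c) ++ (b ++ d)  ∎
  where open PermutationReasoning

module _ {𝒜 : Set} where

  ∼-setoid : Setoid _ _
  ∼-setoid = record
    { Carrier = MQ 𝒜 ; _≈_ = _∼_
    ; isEquivalence = record { refl = ∼-refl ; sym = ∼-sym ; trans = ∼-trans } }

  ⊖-cong : {a a′ b b′ : MQ 𝒜} → a ∼ a′ → b ∼ b′ → a ⊖ b ∼ a′ ⊖ b′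
  ⊖-cong a∼a′ b∼b′ = ∼-⊕ a∼a′ (∼-• (- 1ℚ) b∼b′)

  •-assoc : ∀ q r (a : MQ 𝒜) → q • (r • a) ≡ (q *ℚ r) • a
  •-assoc q r [] = refl
  •-assoc q r ((p , t) ∷ a) = cong₂ _∷_ (cong (_, t) (sym (*-assoc q r p))) (•-assoc q r a)

  •-comm : ∀ q r (a : MQ 𝒜) → q • (r • a) ≡ r • (q • a)
  •-comm q r a = trans (•-assoc q r a) (trans (cong (_• a) (*-comm q r)) (sym (•-assoc r q a)))

  •-⊖ : ∀ c (a b : MQ 𝒜) → c • (a ⊖ b) ≡ c • a ⊖ c • b
  •-⊖ c a b = trans (map-++ _ a ((- 1ℚ) • b)) (cong (c • a ++_) (•-comm c (- 1ℚ) b))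

  -•-involutive : (a : MQ 𝒜) → (- 1ℚ) • ((- 1ℚ) • a) ≡ a
  -•-involutive [] = refl
  -•-involutive ((p , t) ∷ a) = cong₂ _∷_ (cong (_, t) (−1*−1*p≡p p)) (-•-involutive a)
    where
    −1*−1*p≡p : ∀ p → - 1ℚ *ℚ (- 1ℚ *ℚ p) ≡ p
    −1*−1*p≡p = solve 1 (λ p → con (- 1ℚ) :* (con (- 1ℚ) :* p) := p) refl

  ⊖-⊖ : (a b c : MQ 𝒜) → a ⊖ (b ⊖ c) ≡ a ⊖ b ⊕ c
  ⊖-⊖ a b c = begin
    a ++ (- 1ℚ) • (b ++ (- 1ℚ) • c)
      ≡⟨ cong (a ++_) (map-++ _ b ((- 1ℚ) • c)) ⟩
    a ++ ((- 1ℚ) • b ++ (- 1ℚ) • ((- 1ℚ) • c))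
      ≡⟨ cong (λ c′ → a ++ ((- 1ℚ) • b ++ c′)) (-•-involutive c) ⟩
    a ++ ((- 1ℚ) • b ++ c)
      ≡⟨ ++-assoc a ((- 1ℚ) • b) c ⟨
    a ⊖ b ⊕ c
      ∎
    where open ≡-Reasoning

  ⊖-interchange : (a b c d : MQ 𝒜) → (a ⊖ b) ⊕ (c ⊖ d) ↭ (a ⊕ c) ⊖ (b ⊕ d)
  ⊖-interchange a b c d = begin
    (a ⊖ b) ⊕ (c ⊖ d)                          ↭⟨ ++-interchange a ((- 1ℚ) • b) c ((- 1ℚ) • d) ⟩
    (a ⊕ c) ++ ((- 1ℚ) • b ++ (- 1ℚ) • d)      ≡⟨ cong ((a ⊕ c) ++_) (map-++ _ b d) ⟨
    (a ⊕ c) ⊖ (b ⊕ d)                          ∎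
    where open PermutationReasoning

  ⊖-cancel : (a : MQ 𝒜) → a ⊖ a ∼ 0M
  ⊖-cancel [] = ∼-refl
  ⊖-cancel ((q , t) ∷ a) = begin
    (q , t) ∷ (a ++ (- 1ℚ *ℚ q , t) ∷ (- 1ℚ) • a)
      ≈⟨ ∼-⊕ {x = (q , t) ∷ []} ∼-refl (∼-perm (shift _ a _)) ⟩
    (q , t) ∷ (- 1ℚ *ℚ q , t) ∷ a ⊖ a
      ≈⟨ ∼-merge q (- 1ℚ *ℚ q) t (a ⊖ a) ⟩
    (q +ℚ - 1ℚ *ℚ q , t) ∷ a ⊖ a
      ≡⟨ cong (λ p → (p , t) ∷ a ⊖ a) (q−q≡0 q) ⟩
    (0ℚ , t) ∷ a ⊖ a
      ≈⟨ ∼-zero t (a ⊖ a) ⟩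
    a ⊖ a
      ≈⟨ ⊖-cancel a ⟩
    0M
      ∎
    where
    open SetoidReasoning ∼-setoid
    q−q≡0 : ∀ q → q +ℚ - 1ℚ *ℚ q ≡ 0ℚ
    q−q≡0 = solve 1 (λ q → q :+ con (- 1ℚ) :* q := con 0ℚ) refl

  ⊖≈0⇒≈ : {a b : MQ 𝒜} → a ⊖ b ∼ 0M → a ∼ b
  ⊖≈0⇒≈ {a} {b} a−b≈0 = ∼-sym (begin
    b                           ≈⟨ ∼-⊕ {x = []} (∼-sym a−b≈0) ∼-refl ⟩
    (a ⊖ b) ⊕ b                 ≡⟨ ++-assoc a ((- 1ℚ) • b) b ⟩
    a ++ ((- 1ℚ) • b ++ b)      ≈⟨ ∼-perm (++⁺ˡ a (++-comm ((- 1ℚ) • b) b)) ⟩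
    a ++ (b ⊖ b)                ≈⟨ ∼-⊕ ∼-refl (⊖-cancel b) ⟩
    a ++ []                     ≡⟨ ++-identityʳ a ⟩
    a                           ∎)
    where open SetoidReasoning ∼-setoid

  _⋆₁_ : ℚ × Magma 𝒜 → MQ 𝒜 → MQ 𝒜
  (r , t) ⋆₁ z = map (λ { (p , u) → (r *ℚ p , t ⋆ₜ u) }) z
  infixl 7 _⋆₁_

  ⋆-zeroʳ : (y : MQ 𝒜) → y ⋆ 0M ≡ 0M
  ⋆-zeroʳ [] = refl
  ⋆-zeroʳ (i ∷ y) = ⋆-zeroʳ y

  ⋆-distribʳ-⊕ : (a b z : MQ 𝒜) → (a ⊕ b) ⋆ z ≡ a ⋆ z ⊕ b ⋆ z
  ⋆-distribʳ-⊕ a b z = concatMap-++ (_⋆₁ z) a b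

  ⋆₁-distrib-⊕ : ∀ i (a b : MQ 𝒜) → i ⋆₁ (a ⊕ b) ≡ i ⋆₁ a ⊕ i ⋆₁ b
  ⋆₁-distrib-⊕ (r , t) a b = map-++ _ a b

  ⋆-distribˡ-⊕ : (x a b : MQ 𝒜) → x ⋆ (a ⊕ b) ↭ x ⋆ a ⊕ x ⋆ b
  ⋆-distribˡ-⊕ [] a b = ↭-reflexive refl
  ⋆-distribˡ-⊕ (i ∷ x) a b = begin
    i ⋆₁ (a ⊕ b) ++ x ⋆ (a ⊕ b)           ≡⟨ cong (_++ x ⋆ (a ⊕ b)) (⋆₁-distrib-⊕ i a b) ⟩
    (i ⋆₁ a ++ i ⋆₁ b) ++ x ⋆ (a ⊕ b)     ↭⟨ ++⁺ˡ (i ⋆₁ a ++ i ⋆₁ b) (⋆-distribˡ-⊕ x a b) ⟩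
    (i ⋆₁ a ++ i ⋆₁ b) ++ (x ⋆ a ++ x ⋆ b) ↭⟨ ++-interchange (i ⋆₁ a) (i ⋆₁ b) (x ⋆ a) (x ⋆ b) ⟩
    (i ∷ x) ⋆ a ⊕ (i ∷ x) ⋆ b              ∎
    where open PermutationReasoning

  •-⋆-singletonʳ : ∀ c p u (a : MQ 𝒜) → (c *ℚ p) • (a ⋆ ⟦ u ⟧) ≡ (c • a) ⋆ ((p , u) ∷ [])
  •-⋆-singletonʳ c p u [] = refl
  •-⋆-singletonʳ c p u ((q , v) ∷ a) =
    cong₂ _∷_ (cong (_, v ⋆ₜ u) (cp[q1]≡[cq]p c p q)) (•-⋆-singletonʳ c p u a)
    where
    cp[q1]≡[cq]p : ∀ c p q → (c *ℚ p) *ℚ (q *ℚ 1ℚ) ≡ (c *ℚ q) *ℚ p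
    cp[q1]≡[cq]p = solve 3 (λ c p q → (c :* p) :* (q :* con 1ℚ) := (c :* q) :* p) refl

  •-⋆-singletonˡ : ∀ c r t (b : MQ 𝒜) → (c *ℚ r) • (⟦ t ⟧ ⋆ b) ≡ (r , t) ⋆₁ (c • b)
  •-⋆-singletonˡ c r t [] = refl
  •-⋆-singletonˡ c r t ((q , v) ∷ b) =
    cong₂ _∷_ (cong (_, t ⋆ₜ v) (cr[1q]≡r[cq] c r q)) (•-⋆-singletonˡ c r t b)
    where
    cr[1q]≡r[cq] : ∀ c r q → (c *ℚ r) *ℚ (1ℚ *ℚ q) ≡ r *ℚ (c *ℚ q)
    cr[1q]≡r[cq] = solve 3 (λ c r q → (c :* r) :* (con 1ℚ :* q) := r :* (c :* q)) refl

  associator : (MQ 𝒜 → MQ 𝒜 → MQ 𝒜) → MQ 𝒜 → MQ 𝒜 → MQ 𝒜 → MQ 𝒜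
  associator _◇_ x y z = x ◇ (y ◇ z) ⊖ (x ◇ y) ◇ z

  associator-resp : {_▷_ _◁_ : MQ 𝒜 → MQ 𝒜 → MQ 𝒜}
    → (∀ {x x′ y y′} → x ∼ x′ → y ∼ y′ → x ◁ y ∼ x′ ◁ y′)
    → (∀ x y → x ▷ y ∼ x ◁ y)
    → ∀ x y z → associator _▷_ x y z ∼ associator _◁_ x y z
  associator-resp ◁-resp ▷≈◁ x y z = ⊖-cong
    (∼-trans (▷≈◁ _ _) (◁-resp ∼-refl (▷≈◁ y z)))
    (∼-trans (▷≈◁ _ _) (◁-resp (▷≈◁ x y) ∼-refl))

  module _ (f : Magma 𝒜 → 𝒜 → MQ 𝒜) where
    open Extension f

    _▷₁_ : ℚ × Magma 𝒜 → MQ 𝒜 → MQ 𝒜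
    (q , s) ▷₁ w = concatMap (λ { (r , t) → (q *ℚ r) • ▷ₜ s t }) w
    infixr 9 _▷₁_

    ▷-distribʳ-⊕ : (a b w : MQ 𝒜) → (a ⊕ b) ▷ w ≡ a ▷ w ⊕ b ▷ w
    ▷-distribʳ-⊕ a b w = concatMap-++ (_▷₁ w) a b

    ▷₁-distrib-⊕ : ∀ i (a b : MQ 𝒜) → i ▷₁ (a ⊕ b) ≡ i ▷₁ a ⊕ i ▷₁ b
    ▷₁-distrib-⊕ (q , s) a b = concatMap-++ _ a b

    •-▷₁ : ∀ c q s (w : MQ 𝒜) → c • ((q , s) ▷₁ w) ≡ (c *ℚ q , s) ▷₁ w
    •-▷₁ c q s [] = refl
    •-▷₁ c q s ((r , t) ∷ w) = trans (map-++ _ ((q *ℚ r) • ▷ₜ s t) ((q , s) ▷₁ w))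
      (cong₂ _++_ (trans (•-assoc c (q *ℚ r) (▷ₜ s t)) (cong (_• ▷ₜ s t) (sym (*-assoc c q r))))
                  (•-▷₁ c q s w))

    ▷₁-• : ∀ c i (w : MQ 𝒜) → i ▷₁ (c • w) ≡ c • (i ▷₁ w)
    ▷₁-• c i [] = refl
    ▷₁-• c (q , s) ((r , t) ∷ w) = trans
      (cong₂ _++_ (trans (cong (_• ▷ₜ s t) (q[cr]≡c[qr] q c r)) (sym (•-assoc c (q *ℚ r) (▷ₜ s t))))
                  (▷₁-• c (q , s) w))
      (sym (map-++ _ ((q *ℚ r) • ▷ₜ s t) ((q , s) ▷₁ w)))
      where
      q[cr]≡c[qr] : ∀ q c r → q *ℚ (c *ℚ r) ≡ c *ℚ (q *ℚ r)
      q[cr]≡c[qr] = solve 3 (λ q c r → q :* (c :* r) := c :* (q :* r)) refl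

    •-▷ : ∀ c (a w : MQ 𝒜) → (c • a) ▷ w ≡ c • (a ▷ w)
    •-▷ c [] w = refl
    •-▷ c ((q , s) ∷ a) w = trans (cong₂ _++_ (sym (•-▷₁ c q s w)) (•-▷ c a w))
      (sym (map-++ _ ((q , s) ▷₁ w) (a ▷ w)))

    ▷-• : ∀ c (a w : MQ 𝒜) → a ▷ (c • w) ≡ c • (a ▷ w)
    ▷-• c [] w = refl
    ▷-• c (i ∷ a) w = trans (cong₂ _++_ (▷₁-• c i w) (▷-• c a w))
      (sym (map-++ _ (i ▷₁ w) (a ▷ w)))

    •-⟦⟧-▷ : ∀ q t (w : MQ 𝒜) → q • (⟦ t ⟧ ▷ w) ≡ (q , t) ▷₁ w
    •-⟦⟧-▷ q t w = trans (cong (q •_) (++-identityʳ ((1ℚ , t) ▷₁ w)))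
      (trans (•-▷₁ q 1ℚ t w) (cong (λ p → (p , t) ▷₁ w) (*-identityʳ q)))

    ▷₁-⋆₁-leibniz : ∀ q s r t (z : MQ 𝒜) →
      (q , s) ▷₁ ((r , t) ⋆₁ z) ↭ ((q *ℚ r) • ▷ₜ s t) ⋆ z ⊕ (r , t) ⋆₁ ((q , s) ▷₁ z)
    ▷₁-⋆₁-leibniz q s r t [] =
      ↭-reflexive (sym (trans (++-identityʳ (c ⋆ [])) (⋆-zeroʳ c)))
      where c = (q *ℚ r) • ▷ₜ s t
    ▷₁-⋆₁-leibniz q s r t ((p , u) ∷ z) = begin
      (q *ℚ (r *ℚ p)) • (▷ₜ s t ⋆ ⟦ u ⟧ ⊕ ⟦ t ⟧ ⋆ ▷ₜ s u) ++ rest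
        ≡⟨ cong (_++ rest) (map-++ _ (▷ₜ s t ⋆ ⟦ u ⟧) (⟦ t ⟧ ⋆ ▷ₜ s u)) ⟩
      ((q *ℚ (r *ℚ p)) • (▷ₜ s t ⋆ ⟦ u ⟧) ++ (q *ℚ (r *ℚ p)) • (⟦ t ⟧ ⋆ ▷ₜ s u)) ++ rest
        ≡⟨ cong (_++ rest) (cong₂ _++_ acts-on-t acts-on-u) ⟩
      (c ⋆ ((p , u) ∷ []) ++ (r , t) ⋆₁ su) ++ rest
        ↭⟨ ++⁺ˡ (c ⋆ ((p , u) ∷ []) ++ (r , t) ⋆₁ su) (▷₁-⋆₁-leibniz q s r t z) ⟩
      (c ⋆ ((p , u) ∷ []) ++ (r , t) ⋆₁ su) ++ (c ⋆ z ++ (r , t) ⋆₁ sz)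
        ↭⟨ ++-interchange (c ⋆ ((p , u) ∷ [])) ((r , t) ⋆₁ su) (c ⋆ z) ((r , t) ⋆₁ sz) ⟩
      (c ⋆ ((p , u) ∷ []) ++ c ⋆ z) ++ ((r , t) ⋆₁ su ++ (r , t) ⋆₁ sz)
        ↭⟨ ++⁺ (⋆-distribˡ-⊕ c ((p , u) ∷ []) z) (↭-reflexive (⋆₁-distrib-⊕ (r , t) su sz)) ⟨
      c ⋆ ((p , u) ∷ z) ⊕ (r , t) ⋆₁ (su ⊕ sz)
        ∎
      where
      open PermutationReasoning
      c = (q *ℚ r) • ▷ₜ s t
      su = (q *ℚ p) • ▷ₜ s u
      sz = (q , s) ▷₁ z
      rest = (q , s) ▷₁ ((r , t) ⋆₁ z)
      acts-on-t : (q *ℚ (r *ℚ p)) • (▷ₜ s t ⋆ ⟦ u ⟧) ≡ c ⋆ ((p , u) ∷ [])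
      acts-on-t = trans (cong (_• (▷ₜ s t ⋆ ⟦ u ⟧)) (sym (*-assoc q r p)))
                        (•-⋆-singletonʳ (q *ℚ r) p u (▷ₜ s t))
      acts-on-u : (q *ℚ (r *ℚ p)) • (⟦ t ⟧ ⋆ ▷ₜ s u) ≡ (r , t) ⋆₁ su
      acts-on-u = trans (cong (_• (⟦ t ⟧ ⋆ ▷ₜ s u)) (q[rp]≡[qp]r q r p))
                        (•-⋆-singletonˡ (q *ℚ p) r t (▷ₜ s u))
        where
        q[rp]≡[qp]r : ∀ q r p → q *ℚ (r *ℚ p) ≡ (q *ℚ p) *ℚ r
        q[rp]≡[qp]r = solve 3 (λ q r p → q :* (r :* p) := (q :* p) :* r) refl

    ▷₁-⋆-leibniz : ∀ i (y z : MQ 𝒜) → i ▷₁ (y ⋆ z) ↭ (i ▷₁ y) ⋆ z ⊕ y ⋆ (i ▷₁ z)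
    ▷₁-⋆-leibniz i [] z = ↭-reflexive refl
    ▷₁-⋆-leibniz (q , s) ((r , t) ∷ y) z = begin
      (q , s) ▷₁ ((r , t) ⋆₁ z ++ y ⋆ z)
        ≡⟨ ▷₁-distrib-⊕ (q , s) ((r , t) ⋆₁ z) (y ⋆ z) ⟩
      (q , s) ▷₁ ((r , t) ⋆₁ z) ++ (q , s) ▷₁ (y ⋆ z)
        ↭⟨ ++⁺ (▷₁-⋆₁-leibniz q s r t z) (▷₁-⋆-leibniz (q , s) y z) ⟩
      (c ⋆ z ++ (r , t) ⋆₁ sz) ++ (sy ⋆ z ++ y ⋆ sz)
        ↭⟨ ++-interchange (c ⋆ z) ((r , t) ⋆₁ sz) (sy ⋆ z) (y ⋆ sz) ⟩
      (c ⋆ z ++ sy ⋆ z) ++ ((r , t) ⋆₁ sz ++ y ⋆ sz)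
        ≡⟨ cong (_++ ((r , t) ⋆₁ sz ++ y ⋆ sz)) (⋆-distribʳ-⊕ c sy z) ⟨
      ((q , s) ▷₁ ((r , t) ∷ y)) ⋆ z ⊕ ((r , t) ∷ y) ⋆ sz
        ∎
      where
      open PermutationReasoning
      c = (q *ℚ r) • ▷ₜ s t
      sy = (q , s) ▷₁ y
      sz = (q , s) ▷₁ z

    ▷-⋆-leibniz : (x y z : MQ 𝒜) → x ▷ (y ⋆ z) ↭ (x ▷ y) ⋆ z ⊕ y ⋆ (x ▷ z)
    ▷-⋆-leibniz [] y z = ↭-reflexive (sym (⋆-zeroʳ y))
    ▷-⋆-leibniz (i ∷ x) y z = begin
      i ▷₁ (y ⋆ z) ++ x ▷ (y ⋆ z)
        ↭⟨ ++⁺ (▷₁-⋆-leibniz i y z) (▷-⋆-leibniz x y z) ⟩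
      ((i ▷₁ y) ⋆ z ++ y ⋆ (i ▷₁ z)) ++ ((x ▷ y) ⋆ z ++ y ⋆ (x ▷ z))
        ↭⟨ ++-interchange ((i ▷₁ y) ⋆ z) _ ((x ▷ y) ⋆ z) _ ⟩
      ((i ▷₁ y) ⋆ z ++ (x ▷ y) ⋆ z) ++ (y ⋆ (i ▷₁ z) ++ y ⋆ (x ▷ z))
        ↭⟨ ++⁺ (↭-reflexive (⋆-distribʳ-⊕ (i ▷₁ y) (x ▷ y) z)) (⋆-distribˡ-⊕ y (i ▷₁ z) (x ▷ z)) ⟨
      ((i ∷ x) ▷ y) ⋆ z ⊕ y ⋆ ((i ∷ x) ▷ z)
        ∎
      where open PermutationReasoning

    ·-distribʳ-⊕A : (A B C : QA) → (A ⊕A B) · C ≡ A · C ⊕A B · C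
    ·-distribʳ-⊕A A B C = concatMap-++ _ A B

    ▷A-distribʳ-⊕A : (A B : QA) (z : MQ 𝒜) → (A ⊕A B) ▷A z ≡ A ▷A z ⊕ B ▷A z
    ▷A-distribʳ-⊕A A B z = concatMap-++ _ A B

    ▷A-distribʳ-⊖A : (A B : QA) (z : MQ 𝒜) → (A ⊖A B) ▷A z ≡ A ▷A z ⊖ B ▷A z
    ▷A-distribʳ-⊖A A B z = trans (concatMap-++ _ A _) (cong (A ▷A z ++_) (negated B))
      where
      negated : ∀ B → map (λ { (q , w) → (- 1ℚ *ℚ q , w) }) B ▷A z ≡ (- 1ℚ) • (B ▷A z)
      negated [] = refl
      negated ((q , (n , w)) ∷ B) = trans
        (cong₂ _++_ (sym (•-assoc (- 1ℚ) q (▷W n w z))) (negated B))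
        (sym (map-++ _ (q • ▷W n w z) (B ▷A z)))

    ι-▷A : (x z : MQ 𝒜) → ι x ▷A z ≡ x ▷ z
    ι-▷A [] z = refl
    ι-▷A ((q , t) ∷ x) z = cong₂ _++_
      (trans (cong (q •_) (++-identityʳ (⟦ t ⟧ ▷ z))) (•-⟦⟧-▷ q t z)) (ι-▷A x z)

    ▷W-pair : ∀ s t (z : MQ 𝒜) → ▷W 2 (s ∷ᵥ t ∷ᵥ []ᵥ) z ≡ ⟦ s ⟧ ▷ (⟦ t ⟧ ▷ z) ⊖ ▷ₜ s t ▷ z
    ▷W-pair s t z = cong₂ _⊖_ (cong (⟦ s ⟧ ▷_) (++-identityʳ (⟦ t ⟧ ▷ z)))
      (singletons (▷ₜ s t))
      where
      -- the trailing [] is ▷word s []ᵥ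
      singletons : ∀ L → concatMap (λ { (p , B) → p • ▷W 1 B z })
                           (map (λ { (p , u) → (p , u ∷ᵥ []ᵥ) }) L ++ []) ≡ L ▷ z
      singletons [] = refl
      singletons ((p , u) ∷ L) = cong₂ _++_
        (trans (cong (p •_) (++-identityʳ (⟦ u ⟧ ▷ z))) (•-⟦⟧-▷ p u z)) (singletons L)

    •-▷W-pair : ∀ q s r t (z : MQ 𝒜) →
      (q *ℚ r) • ▷W 2 (s ∷ᵥ t ∷ᵥ []ᵥ) z ≡ (q , s) ▷₁ ((r , t) ▷₁ z) ⊖ ((q *ℚ r) • ▷ₜ s t) ▷ z
    •-▷W-pair q s r t z = begin
      (q *ℚ r) • ▷W 2 (s ∷ᵥ t ∷ᵥ []ᵥ) z
        ≡⟨ cong ((q *ℚ r) •_) (▷W-pair s t z) ⟩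
      (q *ℚ r) • (⟦ s ⟧ ▷ (⟦ t ⟧ ▷ z) ⊖ ▷ₜ s t ▷ z)
        ≡⟨ •-⊖ (q *ℚ r) (⟦ s ⟧ ▷ (⟦ t ⟧ ▷ z)) (▷ₜ s t ▷ z) ⟩
      (q *ℚ r) • (⟦ s ⟧ ▷ (⟦ t ⟧ ▷ z)) ⊖ (q *ℚ r) • (▷ₜ s t ▷ z)
        ≡⟨ cong₂ _⊖_ nested (sym (•-▷ (q *ℚ r) (▷ₜ s t) z)) ⟩
      (q , s) ▷₁ ((r , t) ▷₁ z) ⊖ ((q *ℚ r) • ▷ₜ s t) ▷ z
        ∎
      where
      open ≡-Reasoning
      nested : (q *ℚ r) • (⟦ s ⟧ ▷ (⟦ t ⟧ ▷ z)) ≡ (q , s) ▷₁ ((r , t) ▷₁ z)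
      nested = begin
        (q *ℚ r) • (⟦ s ⟧ ▷ (⟦ t ⟧ ▷ z))   ≡⟨ •-assoc q r _ ⟨
        q • (r • (⟦ s ⟧ ▷ (⟦ t ⟧ ▷ z)))    ≡⟨ cong (q •_) (▷-• r ⟦ s ⟧ (⟦ t ⟧ ▷ z)) ⟨
        q • (⟦ s ⟧ ▷ (r • (⟦ t ⟧ ▷ z)))    ≡⟨ •-⟦⟧-▷ q s (r • (⟦ t ⟧ ▷ z)) ⟩
        (q , s) ▷₁ (r • (⟦ t ⟧ ▷ z))        ≡⟨ cong ((q , s) ▷₁_) (•-⟦⟧-▷ r t z) ⟩
        (q , s) ▷₁ ((r , t) ▷₁ z)           ∎

    ι₁·ι-▷A : ∀ q s (y z : MQ 𝒜) →
      (ι ((q , s) ∷ []) · ι y) ▷A z ↭ (q , s) ▷₁ (y ▷ z) ⊖ ((q , s) ▷₁ y) ▷ z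
    ι₁·ι-▷A q s [] z = ↭-reflexive refl
    ι₁·ι-▷A q s ((r , t) ∷ y) z = begin
      (q *ℚ r) • ▷W 2 (s ∷ᵥ t ∷ᵥ []ᵥ) z ++ (ι ((q , s) ∷ []) · ι y) ▷A z
        ↭⟨ ++⁺ (↭-reflexive (•-▷W-pair q s r t z)) (ι₁·ι-▷A q s y z) ⟩
      (a₁ ⊖ b₁) ⊕ (a₂ ⊖ b₂)
        ↭⟨ ⊖-interchange a₁ b₁ a₂ b₂ ⟩
      (a₁ ⊕ a₂) ⊖ (b₁ ⊕ b₂)
        ≡⟨ cong₂ _⊖_ (▷₁-distrib-⊕ (q , s) ((r , t) ▷₁ z) (y ▷ z))
                     (▷-distribʳ-⊕ ((q *ℚ r) • ▷ₜ s t) ((q , s) ▷₁ y) z) ⟨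
      (q , s) ▷₁ (((r , t) ∷ y) ▷ z) ⊖ ((q , s) ▷₁ ((r , t) ∷ y)) ▷ z
        ∎
      where
      open PermutationReasoning
      a₁ = (q , s) ▷₁ ((r , t) ▷₁ z)
      b₁ = ((q *ℚ r) • ▷ₜ s t) ▷ z
      a₂ = (q , s) ▷₁ (y ▷ z)
      b₂ = ((q , s) ▷₁ y) ▷ z

    ι·ι-▷A : (x y z : MQ 𝒜) → (ι x · ι y) ▷A z ↭ associator _▷_ x y z
    ι·ι-▷A [] y z = ↭-reflexive refl
    ι·ι-▷A ((q , s) ∷ x) y z = begin
      (ι ((q , s) ∷ x) · ι y) ▷A z
        ≡⟨ cong (_▷A z) (·-distribʳ-⊕A (ι ((q , s) ∷ [])) (ι x) (ι y)) ⟩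
      (ι ((q , s) ∷ []) · ι y ⊕A ι x · ι y) ▷A z
        ≡⟨ ▷A-distribʳ-⊕A (ι ((q , s) ∷ []) · ι y) (ι x · ι y) z ⟩
      (ι ((q , s) ∷ []) · ι y) ▷A z ⊕ (ι x · ι y) ▷A z
        ↭⟨ ++⁺ (ι₁·ι-▷A q s y z) (ι·ι-▷A x y z) ⟩
      ((q , s) ▷₁ (y ▷ z) ⊖ ((q , s) ▷₁ y) ▷ z) ⊕ (x ▷ (y ▷ z) ⊖ (x ▷ y) ▷ z)
        ↭⟨ ⊖-interchange ((q , s) ▷₁ (y ▷ z)) (((q , s) ▷₁ y) ▷ z) (x ▷ (y ▷ z)) ((x ▷ y) ▷ z) ⟩
      ((q , s) ▷₁ (y ▷ z) ⊕ x ▷ (y ▷ z)) ⊖ (((q , s) ▷₁ y) ▷ z ⊕ (x ▷ y) ▷ z)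
        ≡⟨ cong (((q , s) ∷ x) ▷ (y ▷ z) ⊖_) (▷-distribʳ-⊕ ((q , s) ▷₁ y) (x ▷ y) z) ⟨
      associator _▷_ ((q , s) ∷ x) y z
        ∎
      where open PermutationReasoning

    ⋆-▷≈associator-antisym :
      (∀ x y z → (ι (x ⋆ y) ⊖A ι x · ι y ⊕A ι y · ι x) ▷A z ∼ 0M) →
      ∀ x y z → (x ⋆ y) ▷ z ∼ associator _▷_ x y z ⊖ associator _▷_ y x z
    ⋆-▷≈associator-antisym hyp x y z = ⊖≈0⇒≈ (begin
      (x ⋆ y) ▷ z ⊖ (associator _▷_ x y z ⊖ associator _▷_ y x z)
        ≡⟨ ⊖-⊖ ((x ⋆ y) ▷ z) _ _ ⟩
      (x ⋆ y) ▷ z ⊖ associator _▷_ x y z ⊕ associator _▷_ y x z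
        ≈⟨ ∼-⊕ (⊖-cong ∼-refl (∼-perm (↭-sym (ι·ι-▷A x y z)))) (∼-perm (↭-sym (ι·ι-▷A y x z))) ⟩
      (x ⋆ y) ▷ z ⊖ (ι x · ι y) ▷A z ⊕ (ι y · ι x) ▷A z
        ≡⟨ expand ⟨
      (ι (x ⋆ y) ⊖A ι x · ι y ⊕A ι y · ι x) ▷A z
        ≈⟨ hyp x y z ⟩
      0M
        ∎)
      where
      open SetoidReasoning ∼-setoid
      expand : (ι (x ⋆ y) ⊖A ι x · ι y ⊕A ι y · ι x) ▷A z
             ≡ (x ⋆ y) ▷ z ⊖ (ι x · ι y) ▷A z ⊕ (ι y · ι x) ▷A z
      expand = trans (▷A-distribʳ-⊕A (ι (x ⋆ y) ⊖A ι x · ι y) (ι y · ι x) z)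
        (cong (_⊕ (ι y · ι x) ▷A z)
          (trans (▷A-distribʳ-⊖A (ι (x ⋆ y)) (ι x · ι y) z)
                 (cong (_⊖ (ι x · ι y) ▷A z) (ι-▷A (x ⋆ y) z))))

proposition2p11 : (𝒜 : Set) (f : Magma 𝒜 → 𝒜 → MQ 𝒜)
    → let open Extension f in
      (_◁_ : MQ 𝒜 → MQ 𝒜 → MQ 𝒜)
    → IsBilinearOnLie _◁_
    → (∀ x y → x ▷ y ∼ x ◁ y)
    → (∀ x y z → (ι (x ⋆ y) ⊖A ι x · ι y ⊕A ι y · ι x) ▷A z ∼ 0M)
    → IsPostLieOnLie _◁_
proposition2p11 𝒜 f _◁_ bilinear ▷≈◁ hyp = record
  { derivation = λ x y z → begin
      x ◁ (y ⋆ z)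
        ≈⟨ ▷≈◁ x (y ⋆ z) ⟨
      x ▷ (y ⋆ z)
        ≈⟨ ∼-perm (▷-⋆-leibniz f x y z) ⟩
      (x ▷ y) ⋆ z ⊕ y ⋆ (x ▷ z)
        ≈⟨ ∼-⊕ (∼-⋆ (▷≈◁ x y) (∼-refl {x = z})) (∼-⋆ (∼-refl {x = y}) (▷≈◁ x z)) ⟩
      (x ◁ y) ⋆ z ⊕ y ⋆ (x ◁ z)
        ∎
  ; bracket-act = λ x y z → begin
      (x ⋆ y) ◁ z
        ≈⟨ ▷≈◁ (x ⋆ y) z ⟨
      (x ⋆ y) ▷ z
        ≈⟨ ⋆-▷≈associator-antisym f hyp x y z ⟩
      associator _▷_ x y z ⊖ associator _▷_ y x z
        ≈⟨ ⊖-cong (associator-resp ◁-resp ▷≈◁ x y z) (associator-resp ◁-resp ▷≈◁ y x z) ⟩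
      associator _◁_ x y z ⊖ associator _◁_ y x z
        ≡⟨ ⊖-⊖ (associator _◁_ x y z) (y ◁ (x ◁ z)) ((y ◁ x) ◁ z) ⟩
      x ◁ (y ◁ z) ⊖ (x ◁ y) ◁ z ⊖ y ◁ (x ◁ z) ⊕ (y ◁ x) ◁ z
        ∎
  }
  where
  open Extension f
  open IsBilinearOnLie bilinear using () renaming (resp to ◁-resp)
  open SetoidReasoning ∼-setoid
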